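{- $\zeta(C_3 \square C_3) = 3$, where $C_3$ is the cycle on three vertices.
   Context: The localization game on a connected graph $G$ is played by a Cop controlling $k$ cops and a Robber. The Robber first chooses a vertex $r$, unknown to the Cop. In each turn the Cop probes a set $B=\{b_1,\dots,b_k\}$ of $k$ vertices and receives the distance vector $[d_G(r,b_1),\dots,d_G(r,b_k)]$. If the Cop can determine $r$ exactly, the Cop wins; otherwise the Robber may stay at $r$ or move to a neighbour of $r$, and the next turn begins. The Cop wins if the Robber is located after finitely many turns. The localization number $\zeta(G)$ is the least positive integer $k$ such that the Cop has a winning strategy with $k$ cops. $\square$ denotes the Cartesian product of graphs. -}

module Defs where

open import Data.Bool using (Bool; true; false; _∧_; _∨_; if_then_else_)
open import Data.Nat using (ℕ; zero; suc; _≡ᵇ_; _%_; _≤_; _<_; NonZero)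
open import Data.Fin using (Fin; toℕ)
import Data.Fin.Properties as FinP
open import Data.Product using (_×_; _,_; ∃)
open import Data.Product.Properties using (≡-dec)
open import Data.Sum using (_⊎_)
open import Data.Bool.ListAction using (any)
open import Data.List using (List; []; _∷_; length; allFin; cartesianProduct)
open import Data.Vec using (Vec; map)
open import Relation.Nullary using (¬_; does)
open import Relation.Binary using (DecidableEquality)
open import Relation.Binary.PropositionalEquality using (_≡_)

record Graph : Set₁ where
  field
    V     : Set
    _≟_   : DecidableEquality V
    verts : List V
    adj   : V → V → Bool

module _ (G : Graph) where
  open Graph G

  reach : ℕ → V → V → Bool
  reach zero    u v = does (u ≟ v)
  reach (suc m) u v = reach m u v ∨ any (λ w → reach m u w ∧ adj w v) verts

  private
    search : ℕ → ℕ → V → V → ℕ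
    search zero    m u v = m
    search (suc f) m u v = if reach m u v then m else search f (suc m) u v

  -- graph distance d_G(u,v): length of a shortest u–v walk
  -- (a shortest walk has length < |V|, so the search bound suffices for connected G)
  dist : V → V → ℕ
  dist u v = search (length verts) 0 u v

  Step : V → V → Set
  Step u v = (v ≡ u) ⊎ (adj u v ≡ true)

  -- a Robber trajectory: r 0 is the initial vertex, r (suc t) is the position after turn t
  Trajectory : Set
  Trajectory = ∃ λ (r : ℕ → V) → ∀ t → Step (r t) (r (suc t))

  -- a Cop strategy with k cops: the probe at each turn depends on all previous
  -- answers (list of distance vectors, most recent first)
  Strategy : ℕ → Set
  Strategy k = List (Vec ℕ k) → Vec V k

  answer : ∀ {k} → Vec V k → V → Vec ℕ k
  answer B r = map (dist r) B

  history : ∀ {k} → Strategy k → (ℕ → V) → ℕ → List (Vec ℕ k)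
  history σ r zero    = []
  history σ r (suc t) = answer (σ (history σ r t)) (r t) ∷ history σ r t

  -- after the probe of turn t, the Cop can determine the Robber's current vertex:
  -- every Robber trajectory producing the same answers is at the same vertex now
  Located : ∀ {k} → Strategy k → Trajectory → ℕ → Set
  Located σ (r , _) t =
    ∀ (ρ : Trajectory) → history σ (Data.Product.proj₁ ρ) (suc t) ≡ history σ r (suc t)
      → Data.Product.proj₁ ρ t ≡ r t

  CopWins : ℕ → Set
  CopWins k = ∃ λ (σ : Strategy k) → ∀ (ρ : Trajectory) → ∃ λ t → Located σ ρ t

  LocalizationNumberIs : ℕ → Set
  LocalizationNumberIs k = (1 ≤ k) × CopWins k × (∀ j → 1 ≤ j → j < k → ¬ CopWins j)

Cycle : (n : ℕ) → .{{NonZero n}} → Graph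
Cycle n = record
  { V = Fin n
  ; _≟_ = FinP._≟_
  ; verts = allFin n
  ; adj = λ i j → (toℕ j ≡ᵇ (suc (toℕ i) % n)) ∨ (toℕ i ≡ᵇ (suc (toℕ j) % n))
  }

_□_ : Graph → Graph → Graph
G □ H = record
  { V = G.V × H.V
  ; _≟_ = ≡-dec G._≟_ H._≟_
  ; verts = cartesianProduct G.verts H.verts
  ; adj = λ { (a , b) (c , d) → (does (a G.≟ c) ∧ H.adj b d) ∨ (G.adj a c ∧ does (b H.≟ d)) }
  }
  where
    module G = Graph G
    module H = Graph H

C₃ : Graph
C₃ = Cycle 3

-- C₃ is the complete graph K₃, so C₃ □ C₃ is the 3 × 3 rook's graph and its
-- distance is the Hamming distance. Three cops win at once: the probes (0,0),
-- (0,1), (1,0) separate all nine vertices. Against two cops the Robber keeps,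
-- besides its true position x, a decoy y ≠ x that no answer so far has ruled
-- out; whatever the next two probes are, it can move to some x′ next to x while
-- some y′ ≠ x′ next to x or to y gives the same answers (a finite check), so the
-- Cop is never sure. One cop is no better than two.
module Submission where

open import Defs
open import Data.Bool using (true; if_then_else_)
import Data.Bool.Properties as Bool
open import Data.Fin using (Fin)
import Data.Fin.Properties as Fin
open import Data.Fin.Patterns using (0F; 1F)
open import Data.List using (List; []; _∷_)
import Data.List as List
open import Data.List.Properties using (∷-injectiveˡ)
open import Data.Nat using (ℕ; zero; suc; _+_; _≤_; _<_; _≤?_; z≤n; s≤s)
import Data.Nat.Properties as ℕ
open import Data.Product using (_×_; _,_; ∃; proj₁; map₂)
open import Data.Sum using (_⊎_; inj₁; inj₂)
open import Data.Vec using (Vec; []; _∷_; map; tail)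
import Data.Vec.Properties as Vec
open import Function using (_∘_)
open import Relation.Binary using (tri<; tri≈; tri>)
open import Relation.Binary.PropositionalEquality
  using (_≡_; _≢_; refl; sym; trans; cong; cong₂; subst; subst₂)
open import Relation.Nullary using (Dec; yes; no; does; ¬_; ¬?; contradiction)
open import Relation.Nullary.Decidable using (from-yes; map′; _×-dec_; _⊎-dec_; _→-dec_)
open import Relation.Unary using (Decidable)

module _ (G : Graph) where
  open Graph G

  Step-refl : ∀ {u} → Step G u u
  Step-refl = inj₁ refl

  Step? : ∀ u v → Dec (Step G u v)
  Step? u v = (v ≟ u) ⊎-dec (adj u v Bool.≟ true)

  Resolving : ∀ {k} → Vec V k → Set
  Resolving B = ∀ u v → answer G B u ≡ answer G B v → u ≡ v

  resolving⇒copWins : ∀ {k} {B : Vec V k} → Resolving B → CopWins G k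
  resolving⇒copWins {B = B} resolves =
    (λ _ → B) , λ _ → 0 , λ _ same → resolves _ _ (∷-injectiveˡ same)

  copWins-suc : ∀ {k} → V → CopWins G k → CopWins G (suc k)
  copWins-suc {k} v (σ , wins) = σ′ , λ ρ → map₂ (λ located ρ′ → located ρ′ ∘ forget) (wins ρ)
    where
      σ′ : Strategy G (suc k)
      σ′ h = v ∷ σ (List.map tail h)

      history-tail : ∀ r t → List.map tail (history G σ′ r t) ≡ history G σ r t
      history-tail r zero    = refl
      history-tail r (suc t) = cong (λ h → answer G (σ h) (r t) ∷ h) (history-tail r t)

      forget : ∀ {r r′ t} → history G σ′ r t ≡ history G σ′ r′ t → history G σ r t ≡ history G σ r′ t
      forget {r} {r′} {t} same =
        trans (sym (history-tail r t)) (trans (cong (List.map tail) same) (history-tail r′ t))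

  divert : (ℕ → V) → ℕ → V → ℕ → V
  divert r t v s with s ≤? t
  ... | yes _ = r s
  ... | no _  = v

  divert-≤ : ∀ {r t v s} → s ≤ t → divert r t v s ≡ r s
  divert-≤ {t = t} {s = s} s≤t with s ≤? t
  ... | yes _   = refl
  ... | no s≰t  = contradiction s≤t s≰t

  divert-> : ∀ {r t v s} → t < s → divert r t v s ≡ v
  divert-> {t = t} {s = s} t<s with s ≤? t
  ... | yes s≤t = contradiction s≤t (ℕ.<⇒≱ t<s)
  ... | no _    = refl

  divert-steps : ∀ {r t v} → (∀ s → Step G (r s) (r (suc s))) → Step G (r t) v →
                 ∀ s → Step G (divert r t v s) (divert r t v (suc s))
  divert-steps {r} {t} {v} steps jump s with ℕ.<-cmp s t
  ... | tri< s<t _ _ =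
    subst₂ (Step G) (sym (divert-≤ {r} {t} {v} (ℕ.<⇒≤ s<t))) (sym (divert-≤ {r} {t} {v} s<t)) (steps s)
  ... | tri≈ _ refl _ =
    subst₂ (Step G) (sym (divert-≤ {r} {t} {v} ℕ.≤-refl)) (sym (divert-> {r} {t} {v} (ℕ.n<1+n s))) jump
  ... | tri> _ _ t<s =
    subst₂ (Step G) (sym (divert-> {r} {t} {v} t<s)) (sym (divert-> {r} {t} {v} (ℕ.m<n⇒m<1+n t<s))) Step-refl

  module _ {k} (σ : Strategy G k) where

    history-cong : ∀ {r r′} n → (∀ {s} → s < n → r s ≡ r′ s) → history G σ r n ≡ history G σ r′ n
    history-cong zero    _     = refl
    history-cong (suc n) agree =
      cong₂ (λ h v → answer G (σ h) v ∷ h) (history-cong n (agree ∘ ℕ.m<n⇒m<1+n)) (agree (ℕ.n<1+n n))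

    history-suc-cong : ∀ {r r′ n h} → history G σ r n ≡ h → history G σ r′ n ≡ h →
                       answer G (σ h) (r n) ≡ answer G (σ h) (r′ n) →
                       history G σ r (suc n) ≡ history G σ r′ (suc n)
    history-suc-cong {r′ = r′} {n} refl r′≡ same =
      cong₂ _∷_ (trans same (cong (λ h → answer G (σ h) (r′ n)) (sym r′≡))) (sym r′≡)

  -- x is the Robber's position and y a decoy that all answers so far allow;
  -- both move, y′ along an edge from x or from y, and B cannot tell x′ from y′.
  record Escape {k} (B : Vec V k) (x y : V) : Set where
    constructor escape
    field
      x′    : V
      x⇝x′  : Step G x x′
      y′    : V
      x′≈y′ : answer G B x′ ≡ answer G B y′
      x′≢y′ : x′ ≢ y′
      ⇝y′   : Step G x y′ ⊎ Step G y y′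

  CanEscape : ℕ → Set
  CanEscape k = ∀ x y → x ≢ y → (B : Vec V k) → Escape B x y

  module Chase {k} (escapes : CanEscape k) {x₀ y₀ : V} (x₀≢y₀ : x₀ ≢ y₀) (σ : Strategy G k) where

    record Round : Set where
      field
        x y  : V
        past : List (Vec ℕ k)
        move : Escape (σ past) x y

    -- x₀ and y₀ only seed the first escape: the Robber's start is unconstrained.
    opening : Round
    opening = record { x = x₀ ; y = y₀ ; past = [] ; move = escapes x₀ y₀ x₀≢y₀ (σ []) }

    next : Round → Round
    next round = record { x = x′ ; y = y′ ; past = past′ ; move = escapes x′ y′ x′≢y′ (σ past′) }
      where
        open Round round
        open Escape move
        past′ : List (Vec ℕ k)
        past′ = answer G (σ past) x′ ∷ past

    round : ℕ → Round
    round zero    = opening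
    round (suc t) = next (round t)

    open Round using (past; move)

    robber decoy : ℕ → V
    robber = Escape.x′ ∘ move ∘ round
    decoy  = Escape.y′ ∘ move ∘ round

    Robber : Trajectory G
    Robber = robber , Escape.x⇝x′ ∘ move ∘ round ∘ suc

    history-robber : ∀ t → history G σ robber t ≡ past (round t)
    history-robber zero    = refl
    history-robber (suc t) = cong (λ h → answer G (σ h) (robber t) ∷ h) (history-robber t)

    decoy≈robber : ∀ t → answer G (σ (past (round t))) (decoy t) ≡ answer G (σ (past (round t))) (robber t)
    decoy≈robber t = sym (Escape.x′≈y′ (move (round t)))

    record Decoy (t : ℕ) : Set where
      field
        path   : Trajectory G
        at     : proj₁ path t ≡ decoy t
        agrees : history G σ (proj₁ path) (suc t) ≡ history G σ robber (suc t)

    extend : ∀ t (ρ : Trajectory G) → Step G (proj₁ ρ t) (decoy (suc t)) →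
             history G σ (proj₁ ρ) (suc t) ≡ history G σ robber (suc t) → Decoy (suc t)
    extend t (r , steps) jump agrees = record
      { path   = r′ , divert-steps steps jump
      ; at     = r′-at
      ; agrees = history-suc-cong σ
          (trans (history-cong σ (suc t) (divert-≤ ∘ ℕ.m<1+n⇒m≤n)) (trans agrees (history-robber (suc t))))
          (history-robber (suc t))
          (trans (cong (answer G (σ (past (round (suc t))))) r′-at) (decoy≈robber (suc t)))
      }
      where
        r′ : ℕ → V
        r′ = divert r t (decoy (suc t))
        r′-at : r′ (suc t) ≡ decoy (suc t)
        r′-at = divert-> {r} (ℕ.n<1+n t)

    decoyAt : ∀ t → Decoy t
    decoyAt zero = record
      { path = (λ _ → decoy 0) , λ _ → Step-refl ; at = refl ; agrees = cong (_∷ []) (decoy≈robber 0) }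
    decoyAt (suc t) with Escape.⇝y′ (move (round (suc t)))
    ... | inj₁ from-robber = extend t Robber from-robber refl
    ... | inj₂ from-decoy  = extend t path (subst (λ u → Step G u (decoy (suc t))) (sym at) from-decoy) agrees
      where open Decoy (decoyAt t)

    never-located : ¬ ∃ (Located G σ Robber)
    never-located (t , located) = Escape.x′≢y′ (move (round t)) (trans (sym (located path agrees)) at)
      where open Decoy (decoyAt t)

  canEscape⇒¬copWins : ∀ {k} → CanEscape k → ∀ {x₀ y₀} → x₀ ≢ y₀ → ¬ CopWins G k
  canEscape⇒¬copWins escapes x₀≢y₀ (σ , wins) = never-located (wins Robber)
    where open Chase escapes x₀≢y₀ σ

module _ {m n : ℕ} where

  ∀²? : {P : Fin m × Fin n → Set} → Decidable P → Dec (∀ v → P v)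
  ∀²? P? = map′ (λ all (a , b) → all a b) (λ all a b → all (a , b)) (Fin.all? λ a → Fin.all? λ b → P? (a , b))

  ∃²? : {P : Fin m × Fin n → Set} → Decidable P → Dec (∃ P)
  ∃²? P? = map′ (λ (a , b , p) → (a , b) , p) (λ ((a , b) , p) → a , b , p) (Fin.any? λ a → Fin.any? λ b → P? (a , b))

  hamming : Fin m × Fin n → Fin m × Fin n → ℕ
  hamming (a , b) (c , d) = differ a c + differ b d
    where
      differ : ∀ {l} → Fin l → Fin l → ℕ
      differ i j = if does (i Fin.≟ j) then 0 else 1

open Graph (C₃ □ C₃) using (_≟_)

dist≡hamming : ∀ u v → dist (C₃ □ C₃) u v ≡ hamming u v
dist≡hamming = from-yes (∀²? λ u → ∀²? λ v → dist (C₃ □ C₃) u v ℕ.≟ hamming u v)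

answer≡hamming : ∀ {k} (B : Vec (Fin 3 × Fin 3) k) v → answer (C₃ □ C₃) B v ≡ map (hamming v) B
answer≡hamming B v = Vec.map-cong (dist≡hamming v) B

-- Goes through hamming because dist is far too slow to evaluate in the exhaustive checks.
answer≟ : ∀ {k} (B : Vec (Fin 3 × Fin 3) k) u v → Dec (answer (C₃ □ C₃) B u ≡ answer (C₃ □ C₃) B v)
answer≟ B u v =
  map′ (λ same → trans (answer≡hamming B u) (trans same (sym (answer≡hamming B v))))
       (λ same → trans (sym (answer≡hamming B u)) (trans same (answer≡hamming B v)))
       (Vec.≡-dec ℕ._≟_ (map (hamming u) B) (map (hamming v) B))

Escape? : ∀ {k} (B : Vec (Fin 3 × Fin 3) k) x y → Dec (Escape (C₃ □ C₃) B x y)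
Escape? B x y =
  map′ (λ (x′ , x⇝x′ , y′ , x′≈y′ , x′≢y′ , ⇝y′) → escape x′ x⇝x′ y′ x′≈y′ x′≢y′ ⇝y′)
       (λ (escape x′ x⇝x′ y′ x′≈y′ x′≢y′ ⇝y′) → x′ , x⇝x′ , y′ , x′≈y′ , x′≢y′ , ⇝y′)
       (∃²? λ x′ → Step? (C₃ □ C₃) x x′ ×-dec ∃²? λ y′ →
          answer≟ B x′ y′ ×-dec ¬? (x′ ≟ y′) ×-dec (Step? (C₃ □ C₃) x y′ ⊎-dec Step? (C₃ □ C₃) y y′))

canEscape-two-cops : CanEscape (C₃ □ C₃) 2
canEscape-two-cops x y x≢y (b₁ ∷ b₂ ∷ []) = escapes x y b₁ b₂ x≢y
  where
    escapes : ∀ x y b₁ b₂ → x ≢ y → Escape (C₃ □ C₃) (b₁ ∷ b₂ ∷ []) x y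
    escapes = from-yes (∀²? λ x → ∀²? λ y → ∀²? λ b₁ → ∀²? λ b₂ →
                ¬? (x ≟ y) →-dec Escape? (b₁ ∷ b₂ ∷ []) x y)

corners-resolving : Resolving (C₃ □ C₃) ((0F , 0F) ∷ (0F , 1F) ∷ (1F , 0F) ∷ [])
corners-resolving = from-yes (∀²? λ u → ∀²? λ v → answer≟ ((0F , 0F) ∷ (0F , 1F) ∷ (1F , 0F) ∷ []) u v →-dec (u ≟ v))

proposition5p10 : LocalizationNumberIs (C₃ □ C₃) 3
proposition5p10 = s≤s z≤n , resolving⇒copWins (C₃ □ C₃) corners-resolving , fewer-cops-lose
  where
    two-cops-lose : ¬ CopWins (C₃ □ C₃) 2
    two-cops-lose = canEscape⇒¬copWins (C₃ □ C₃) canEscape-two-cops {0F , 0F} {0F , 1F} λ ()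

    fewer-cops-lose : ∀ j → 1 ≤ j → j < 3 → ¬ CopWins (C₃ □ C₃) j
    fewer-cops-lose 1 _ _ = two-cops-lose ∘ copWins-suc (C₃ □ C₃) (0F , 0F)
    fewer-cops-lose 2 _ _ = two-cops-lose
    fewer-cops-lose (suc (suc (suc _))) _ (s≤s (s≤s (s≤s ())))
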